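{- Let $n\ge1$ and $k\ge1$ be integers. Let $\Upsilon_1=\{(1\text{ - }2,0~0),(2\text{ - }1,0~0)\}$, $\Upsilon_2=\{(1\text{ - }2,1~0),(2\text{ - }1,1~0)\}$, $\Upsilon_3=\{(1\text{ - }2,0~0),(1\text{ - }2,1~0),(2\text{ - }1,0~0),(2\text{ - }1,1~0)\}$, $\Upsilon_4=\{(1\text{ - }2,0~1),(1\text{ - }2,1~0),(2\text{ - }1,0~1),(2\text{ - }1,1~0)\}$. Then (1) $Av_{n,k}^{\Upsilon_1}=\binom{k}{n}\,n!\,n!$; (2) $Av_{n,k}^{\Upsilon_2}=\binom{n+k-1}{n}\,n!$; (3) $Av_{n,k}^{\Upsilon_3}=\binom{k}{n}\,n!$; (4) $Av_{n,k}^{\Upsilon_4}=k\,n!$.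
   Context: For integers $k\ge1$, $n\ge0$, $C_k\wr S_n$ denotes the set of pairs $(\sigma,w)$ where $\sigma=\sigma_1\cdots\sigma_n$ is a permutation of $\{1,\dots,n\}$ in one-line notation and $w=w_1\cdots w_n\in\{0,1,\dots,k-1\}^n$. For a sequence of distinct integers, $\mathrm{red}$ replaces the $i$-th smallest entry by $i$; for a word over nonnegative integers, $\mathrm{red}$ replaces every occurrence of the $i$-th smallest distinct letter by $i-1$. A pattern $(\tau,u)$ has $\tau\in S_j$ and $u$ a word of length $j$ with $\mathrm{red}(u)=u$; e.g. $(2\text{ - }1,1~0)$ means $\tau=21$, $u=10$. $(\tau,u)$ bi-occurs in $(\sigma,w)$ if there are $1\le i_1<\cdots<i_j\le n$ (not necessarily adjacent) with $\mathrm{red}(\sigma_{i_1}\cdots\sigma_{i_j})=\tau$ and $\mathrm{red}(w_{i_1}\cdots w_{i_j})=u$. $(\sigma,w)$ bi-avoids a set of patterns if no pattern of the set bi-occurs in it. $Av_{n,k}^{\Upsilon}$ denotes the number of elements of $C_k\wr S_n$ bi-avoiding the set $\Upsilon$. Here $\binom{k}{n}=0$ when $n>k$. -}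

module Defs where

open import Data.Bool using (Bool; true; false; _∧_; not; if_then_else_)
open import Data.Nat using (ℕ; zero; suc; _<ᵇ_; _≡ᵇ_)
open import Data.List using (List; []; _∷_; map; length; filterᵇ; concatMap; _++_; upTo; zip; deduplicateᵇ)
open import Data.Bool.ListAction using (all; any)
open import Data.Product using (_×_; _,_; proj₁; proj₂)

wordsOver : List ℕ → ℕ → List (List ℕ)
wordsOver A zero    = [] ∷ []
wordsOver A (suc n) = concatMap (λ a → map (a ∷_) (wordsOver A n)) A

distinctᵇ : List ℕ → Bool
distinctᵇ []       = true
distinctᵇ (x ∷ xs) = not (any (λ y → x ≡ᵇ y) xs) ∧ distinctᵇ xs

eqListᵇ : List ℕ → List ℕ → Bool
eqListᵇ []       []       = true
eqListᵇ (x ∷ xs) (y ∷ ys) = (x ≡ᵇ y) ∧ eqListᵇ xs ys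
eqListᵇ _        _        = false

-- S_n: permutations of {1,…,n} in one-line notation
-- (length-n words over {1,…,n} with distinct entries)
perms : ℕ → List (List ℕ)
perms n = filterᵇ distinctᵇ (wordsOver (map suc (upTo n)) n)

kwords : ℕ → ℕ → List (List ℕ)
kwords k n = wordsOver (upTo k) n

-- C_k ≀ S_n: all pairs (σ , w)
wreath : ℕ → ℕ → List (List ℕ × List ℕ)
wreath k n = concatMap (λ σ → map (σ ,_) (kwords k n)) (perms n)

#below : ℕ → List ℕ → ℕ
#below x xs = length (filterᵇ (λ y → y <ᵇ x) xs)

redPerm : List ℕ → List ℕ
redPerm xs = map (λ x → suc (#below x xs)) xs

redWord : List ℕ → List ℕ
redWord xs = map (λ x → #below x (deduplicateᵇ _≡ᵇ_ xs)) xs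

subseqs : {A : Set} → List A → List (List A)
subseqs []       = [] ∷ []
subseqs (x ∷ xs) = subseqs xs ++ map (x ∷_) (subseqs xs)

Pattern : Set
Pattern = List ℕ × List ℕ

biOccursᵇ : Pattern → List ℕ × List ℕ → Bool
biOccursᵇ (τ , u) (σ , w) =
  any (λ s → eqListᵇ (redPerm (map proj₁ s)) τ ∧ eqListᵇ (redWord (map proj₂ s)) u)
      (subseqs (zip σ w))

biAvoidsᵇ : List Pattern → List ℕ × List ℕ → Bool
biAvoidsᵇ Υ p = all (λ π → not (biOccursᵇ π p)) Υ

Av : ℕ → ℕ → List Pattern → ℕ
Av n k Υ = length (filterᵇ (biAvoidsᵇ Υ) (wreath k n))

-- the four pattern sets; (1-2, 0 0) is ((1 ∷ 2 ∷ []) , (0 ∷ 0 ∷ [])) etc.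
p12 p21 : List ℕ
p12 = 1 ∷ 2 ∷ []
p21 = 2 ∷ 1 ∷ []

w00 w01 w10 : List ℕ
w00 = 0 ∷ 0 ∷ []
w01 = 0 ∷ 1 ∷ []
w10 = 1 ∷ 0 ∷ []

Υ₁ Υ₂ Υ₃ Υ₄ : List Pattern
Υ₁ = (p12 , w00) ∷ (p21 , w00) ∷ []
Υ₂ = (p12 , w10) ∷ (p21 , w10) ∷ []
Υ₃ = (p12 , w00) ∷ (p12 , w10) ∷ (p21 , w00) ∷ (p21 , w10) ∷ []
Υ₄ = (p12 , w01) ∷ (p12 , w10) ∷ (p21 , w01) ∷ (p21 , w10) ∷ []

-- Every pattern in Υ₁, …, Υ₄ has length 2, and each set contains (1-2, u) exactly when it
-- contains (2-1, u). Since σ has distinct entries, every pair of positions i < j carries 1-2 or 2-1, so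
-- (σ , w) bi-avoids Υ iff no pair of positions i < j of w has letters related by a relation R:
-- wᵢ = wⱼ for Υ₁, wᵢ > wⱼ for Υ₂, wᵢ ≥ wⱼ for Υ₃ and wᵢ ≠ wⱼ for Υ₄. Hence Av = n! · #{w avoiding R},
-- and the words avoiding R are the injective, weakly increasing, strictly increasing and constant
-- words, of which there are k(k-1)⋯(k-n+1) = C(k,n) n!, C(n+k-1,n), C(k,n) and k. Each count is by
-- induction on the length, splitting on the first letter, which restricts the letters allowed after it;
-- for the increasing words the resulting sums are hockey-stick identities.

module Submission where

open import Defs
open import Data.Nat using (ℕ; _+_; _*_; _∸_; _≤_; _!)
open import Data.Nat.Combinatorics using (_C_)
open import Data.Product using (_×_)
open import Relation.Binary.PropositionalEquality using (_≡_)

open import Algebra.Bundles using (CommutativeMonoid)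
import Algebra.Properties.CommutativeSemigroup as CommutativeSemigroupProperties
open import Data.Bool using (Bool; true; false; _∧_; _∨_; not; if_then_else_; T)
open import Data.Bool.ListAction using (all; any; or)
open import Data.Bool.Properties
  using (∧-assoc; ∧-zeroʳ; ∧-identityʳ; ∧-idem; ∧-inverseʳ; ∨-assoc; ∨-identityʳ; ∨-comm; not-involutive; ¬-not;
         T-≡; T-∧; ∨-commutativeMonoid; ∧-commutativeMonoid)
open import Data.List using (List; []; _∷_; map; length; filterᵇ; concatMap; _++_; upTo; applyUpTo; zip)
open import Data.List.Properties using (length-++; filter-++; length-applyUpTo; map-upTo; map-∘; length-map)
open import Data.List.Relation.Unary.All as All using (All; []; _∷_)
open import Data.List.Relation.Unary.All.Properties using (concat⁺; map⁺; applyUpTo⁺₂; all-filter; filter⁺)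
open import Data.Nat using (zero; suc; _<_; _<ᵇ_; _≤ᵇ_; _≡ᵇ_; z≤n; s≤s)
open import Data.Nat.Combinatorics using (nCk+nC[k+1]≡[n+1]C[k+1]; k>n⇒nCk≡0; nC1≡n)
open import Data.Nat.ListAction using (sum)
open import Data.Nat.Properties
  using (+-identityʳ; +-assoc; +-suc; *-identityʳ; *-zeroʳ; *-comm; *-assoc; *-distribˡ-+; ≤-refl; ≤-reflexive;
         ≤-trans; n≤1+n; 0∸n≡0; 1+n≢0; 0≢1+n; suc-injective; <-cmp; <⇒≤; <⇒≱; <⇒≢; >⇒≢; <⇒<ᵇ; <ᵇ⇒<; ≤ᵇ⇒≤;
         ≤⇒≤ᵇ; ≡ᵇ⇒≡; ≡⇒≡ᵇ)
open import Data.Product using (_,_; proj₁; proj₂)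
open import Data.Sum using (_⊎_; inj₁; inj₂)
open import Function using (_∘_; Equivalence)
open import Relation.Binary.Definitions using (tri<; tri≈; tri>)
open import Relation.Binary.PropositionalEquality using (_≢_; refl; sym; trans; cong; cong₂; module ≡-Reasoning)
open import Relation.Nullary.Decidable using (T?)

private
  variable
    A B : Set
  module ∨ = CommutativeSemigroupProperties (CommutativeMonoid.commutativeSemigroup ∨-commutativeMonoid)
  module ∧ = CommutativeSemigroupProperties (CommutativeMonoid.commutativeSemigroup ∧-commutativeMonoid)

not-∨ : ∀ a b → not (a ∨ b) ≡ not a ∧ not b
not-∨ true  b = refl
not-∨ false b = refl

any-∨ : (p q : A → Bool) (xs : List A) → any (λ x → p x ∨ q x) xs ≡ any p xs ∨ any q xs
any-∨ p q []       = refl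
any-∨ p q (x ∷ xs) =
  trans (cong ((p x ∨ q x) ∨_) (any-∨ p q xs)) (∨.interchange (p x) (q x) (any p xs) (any q xs))

all-∧ : (p q : A → Bool) (xs : List A) → all (λ x → p x ∧ q x) xs ≡ all p xs ∧ all q xs
all-∧ p q []       = refl
all-∧ p q (x ∷ xs) =
  trans (cong ((p x ∧ q x) ∧_) (all-∧ p q xs)) (∧.interchange (p x) (q x) (all p xs) (all q xs))

not-any : (p : A → Bool) (xs : List A) → not (any p xs) ≡ all (not ∘ p) xs
not-any p []       = refl
not-any p (x ∷ xs) = trans (not-∨ (p x) (any p xs)) (cong (not (p x) ∧_) (not-any p xs))

any-none : {p : A → Bool} → (∀ x → p x ≡ false) → (xs : List A) → any p xs ≡ false
any-none         none []       = refl
any-none {p = p} none (x ∷ xs) = trans (cong (_∨ any p xs) (none x)) (any-none none xs)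

all-const-true : (xs : List A) → all (λ _ → true) xs ≡ true
all-const-true []       = refl
all-const-true (x ∷ xs) = all-const-true xs

all-cong : {p q : A → Bool} → (∀ x → p x ≡ q x) → (xs : List A) → all p xs ≡ all q xs
all-cong p≗q []       = refl
all-cong p≗q (x ∷ xs) = cong₂ _∧_ (p≗q x) (all-cong p≗q xs)

any-++ : (f : A → Bool) (xs ys : List A) → any f (xs ++ ys) ≡ any f xs ∨ any f ys
any-++ f []       ys = refl
any-++ f (x ∷ xs) ys = trans (cong (f x ∨_) (any-++ f xs ys)) (sym (∨-assoc (f x) (any f xs) (any f ys)))

anyPair : (A → A → Bool) → List A → Bool
anyPair R []       = false
anyPair R (x ∷ xs) = any (R x) xs ∨ anyPair R xs

anyPair-∨ : (R S : A → A → Bool) (xs : List A) →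
  anyPair (λ x y → R x y ∨ S x y) xs ≡ anyPair R xs ∨ anyPair S xs
anyPair-∨ R S []       = refl
anyPair-∨ R S (x ∷ xs) =
  trans (cong₂ _∨_ (any-∨ (R x) (S x) xs) (anyPair-∨ R S xs))
        (∨.interchange (any (R x) xs) (any (S x) xs) (anyPair R xs) (anyPair S xs))

anyPair-const-false : (xs : List A) → anyPair (λ _ _ → false) xs ≡ false
anyPair-const-false []       = refl
anyPair-const-false (x ∷ xs) =
  trans (cong (_∨ anyPair (λ _ _ → false) xs) (any-none (λ _ → refl) xs)) (anyPair-const-false xs)

pairFreeᵇ : (ℕ → ℕ → Bool) → (ℕ → Bool) → List ℕ → Bool
pairFreeᵇ R P w = all P w ∧ not (anyPair R w)

pairFreeᵇ-const-true : (R : ℕ → ℕ → Bool) (w : List ℕ) → pairFreeᵇ R (λ _ → true) w ≡ not (anyPair R w)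
pairFreeᵇ-const-true R w = cong (_∧ not (anyPair R w)) (all-const-true w)

pairFreeᵇ-cong : (R : ℕ → ℕ → Bool) {P Q : ℕ → Bool} → (∀ y → P y ≡ Q y) →
  ∀ w → pairFreeᵇ R P w ≡ pairFreeᵇ R Q w
pairFreeᵇ-cong R P≗Q w = cong (_∧ not (anyPair R w)) (all-cong P≗Q w)

pairFreeᵇ-∷ : (R : ℕ → ℕ → Bool) (P : ℕ → Bool) (a : ℕ) (w : List ℕ) →
  pairFreeᵇ R P (a ∷ w) ≡ P a ∧ pairFreeᵇ R (λ y → P y ∧ not (R a y)) w
pairFreeᵇ-∷ R P a w = begin
  (P a ∧ all P w) ∧ not (any (R a) w ∨ anyPair R w)
    ≡⟨ cong ((P a ∧ all P w) ∧_) (not-∨ (any (R a) w) (anyPair R w)) ⟩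
  (P a ∧ all P w) ∧ (not (any (R a) w) ∧ not (anyPair R w))
    ≡⟨ ∧-assoc (P a) (all P w) _ ⟩
  P a ∧ (all P w ∧ (not (any (R a) w) ∧ not (anyPair R w)))
    ≡⟨ cong (P a ∧_) (sym (∧-assoc (all P w) _ _)) ⟩
  P a ∧ ((all P w ∧ not (any (R a) w)) ∧ not (anyPair R w))
    ≡⟨ cong (λ z → P a ∧ ((all P w ∧ z) ∧ not (anyPair R w))) (not-any (R a) w) ⟩
  P a ∧ ((all P w ∧ all (not ∘ R a) w) ∧ not (anyPair R w))
    ≡⟨ cong (λ z → P a ∧ (z ∧ not (anyPair R w))) (sym (all-∧ P (not ∘ R a) w)) ⟩
  P a ∧ pairFreeᵇ R (λ y → P y ∧ not (R a y)) w ∎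
  where open ≡-Reasoning

count : (A → Bool) → List A → ℕ
count p xs = length (filterᵇ p xs)

count-++ : (p : A → Bool) (xs ys : List A) → count p (xs ++ ys) ≡ count p xs + count p ys
count-++ p xs ys = trans (cong length (filter-++ (T? ∘ p) xs ys)) (length-++ (filterᵇ p xs))

count-map : (p : B → Bool) (f : A → B) (xs : List A) → count p (map f xs) ≡ count (p ∘ f) xs
count-map p f []       = refl
count-map p f (x ∷ xs) with p (f x)
... | true  = cong suc (count-map p f xs)
... | false = count-map p f xs

count-congᴬ : {p q : A → Bool} {xs : List A} → All (λ x → p x ≡ q x) xs → count p xs ≡ count q xs
count-congᴬ []                                  = refl
count-congᴬ {p = p} {q} {x ∷ xs} (px≡qx ∷ eqs) with p x | q x
... | true  | true  = cong suc (count-congᴬ eqs)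
... | false | false = count-congᴬ eqs

count-cong : {p q : A → Bool} → (∀ x → p x ≡ q x) → (xs : List A) → count p xs ≡ count q xs
count-cong p≗q xs = count-congᴬ (All.universal p≗q xs)

count-const-false : (xs : List A) → count (λ _ → false) xs ≡ 0
count-const-false []       = refl
count-const-false (x ∷ xs) = count-const-false xs

count-const-true : (xs : List A) → count (λ _ → true) xs ≡ length xs
count-const-true []       = refl
count-const-true (x ∷ xs) = cong suc (count-const-true xs)

count-∧ˡ : (b : Bool) (p : A → Bool) (xs : List A) →
  count (λ x → b ∧ p x) xs ≡ (if b then count p xs else 0)
count-∧ˡ true  p xs = refl
count-∧ˡ false p xs = count-const-false xs

∑ : ℕ → (ℕ → ℕ) → ℕ
∑ k f = sum (applyUpTo f k)

∑-cong : ∀ k {f g : ℕ → ℕ} → (∀ i → i < k → f i ≡ g i) → ∑ k f ≡ ∑ k g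
∑-cong zero    f≗g = refl
∑-cong (suc k) f≗g = cong₂ _+_ (f≗g 0 (s≤s z≤n)) (∑-cong k (λ i i<k → f≗g (suc i) (s≤s i<k)))

∑-const : ∀ k c → ∑ k (λ _ → c) ≡ k * c
∑-const zero    c = refl
∑-const (suc k) c = cong (c +_) (∑-const k c)

∑-indicator : (p : ℕ → Bool) (g : ℕ → ℕ) (k c : ℕ) →
  ∑ k (λ i → if p (g i) then c else 0) ≡ count p (applyUpTo g k) * c
∑-indicator p g zero    c = refl
∑-indicator p g (suc k) c with p (g 0)
... | true  = cong (c +_) (∑-indicator p (g ∘ suc) k c)
... | false = ∑-indicator p (g ∘ suc) k c

count-concatMap : (p : B → Bool) (F : A → List B) (g : ℕ → A) (k : ℕ) →
  count p (concatMap F (applyUpTo g k)) ≡ ∑ k (λ i → count p (F (g i)))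
count-concatMap p F g zero    = refl
count-concatMap p F g (suc k) =
  trans (count-++ p (F (g 0)) _) (cong (count p (F (g 0)) +_) (count-concatMap p F (g ∘ suc) k))

any-subseqs-∷ : (h : List A → Bool) (x : A) (xs : List A) →
  any h (subseqs (x ∷ xs)) ≡ any h (subseqs xs) ∨ any (λ s → h (x ∷ s)) (subseqs xs)
any-subseqs-∷ h x xs =
  trans (any-++ h (subseqs xs) _) (cong (any h (subseqs xs) ∨_) (cong or (sym (map-∘ (subseqs xs)))))

any-subseqs-length₀ : (h : List A → Bool) → (∀ s → h s ≡ true → length s ≡ 0) →
  ∀ xs → any h (subseqs xs) ≡ h []
any-subseqs-length₀ h supp []       = ∨-identityʳ (h [])
any-subseqs-length₀ h supp (x ∷ xs) =
  trans (any-subseqs-∷ h x xs)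
  (trans (cong₂ _∨_ (any-subseqs-length₀ h supp xs)
                    (any-none (λ s → ¬-not (λ e → 1+n≢0 (supp (x ∷ s) e))) (subseqs xs)))
         (∨-identityʳ (h [])))

any-subseqs-length₁ : (h : List A → Bool) → (∀ s → h s ≡ true → length s ≡ 1) →
  ∀ xs → any h (subseqs xs) ≡ any (λ y → h (y ∷ [])) xs
any-subseqs-length₁ h supp []       = trans (∨-identityʳ (h [])) (¬-not (λ e → 0≢1+n (supp [] e)))
any-subseqs-length₁ h supp (x ∷ xs) =
  trans (any-subseqs-∷ h x xs)
  (trans (cong₂ _∨_ (any-subseqs-length₁ h supp xs)
                    (any-subseqs-length₀ (λ s → h (x ∷ s)) (λ s e → suc-injective (supp (x ∷ s) e)) xs))
         (∨-comm _ (h (x ∷ []))))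

any-subseqs-length₂ : (h : List A → Bool) → (∀ s → h s ≡ true → length s ≡ 2) →
  ∀ xs → any h (subseqs xs) ≡ anyPair (λ y z → h (y ∷ z ∷ [])) xs
any-subseqs-length₂ h supp []       = trans (∨-identityʳ (h [])) (¬-not (λ e → 0≢1+n (supp [] e)))
any-subseqs-length₂ h supp (x ∷ xs) =
  trans (any-subseqs-∷ h x xs)
  (trans (cong₂ _∨_ (any-subseqs-length₂ h supp xs)
                    (any-subseqs-length₁ (λ s → h (x ∷ s)) (λ s e → suc-injective (supp (x ∷ s) e)) xs))
         (∨-comm _ (any (λ z → h (x ∷ z ∷ [])) xs)))

eqListᵇ-length : ∀ xs ys → eqListᵇ xs ys ≡ true → length xs ≡ length ys
eqListᵇ-length []       []       _  = refl
eqListᵇ-length (x ∷ xs) (y ∷ ys) eq with x ≡ᵇ y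
eqListᵇ-length (x ∷ xs) (y ∷ ys) eq | true  = cong suc (eqListᵇ-length xs ys eq)
eqListᵇ-length (x ∷ xs) (y ∷ ys) () | false

occursInᵇ : Pattern → List (ℕ × ℕ) → Bool
occursInᵇ π s = eqListᵇ (redPerm (map proj₁ s)) (proj₁ π) ∧ eqListᵇ (redWord (map proj₂ s)) (proj₂ π)

occursInᵇ-length : ∀ π s → occursInᵇ π s ≡ true → length s ≡ length (proj₁ π)
occursInᵇ-length π s occ with eqListᵇ (redPerm (map proj₁ s)) (proj₁ π) in e
occursInᵇ-length π s occ | true  =
  trans (sym (trans (length-map (λ x → suc (#below x (map proj₁ s))) (map proj₁ s)) (length-map proj₁ s)))
        (eqListᵇ-length (redPerm (map proj₁ s)) (proj₁ π) e)
occursInᵇ-length π s ()  | false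

memberᵇ : Pattern → List Pattern → Bool
memberᵇ (τ , u) Υ = any (λ π → eqListᵇ τ (proj₁ π) ∧ eqListᵇ u (proj₂ π)) Υ

pairOccursᵇ : List Pattern → ℕ × ℕ → ℕ × ℕ → Bool
pairOccursᵇ Υ p q = memberᵇ (redPerm (proj₁ p ∷ proj₁ q ∷ []) , redWord (proj₂ p ∷ proj₂ q ∷ [])) Υ

biOccurs-pairs : ∀ π → length (proj₁ π) ≡ 2 → ∀ σ w →
  biOccursᵇ π (σ , w) ≡ anyPair (λ p q → occursInᵇ π (p ∷ q ∷ [])) (zip σ w)
biOccurs-pairs (τ , u) l σ w =
  any-subseqs-length₂ (occursInᵇ (τ , u)) (λ s e → trans (occursInᵇ-length (τ , u) s e) l) (zip σ w)

biAvoids-pairs : (Υ : List Pattern) → All (λ π → length (proj₁ π) ≡ 2) Υ → ∀ σ w →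
  biAvoidsᵇ Υ (σ , w) ≡ not (anyPair (pairOccursᵇ Υ) (zip σ w))
biAvoids-pairs []      []       σ w = sym (cong not (anyPair-const-false (zip σ w)))
biAvoids-pairs (π ∷ Υ) (l ∷ ls) σ w = begin
  not (biOccursᵇ π (σ , w)) ∧ biAvoidsᵇ Υ (σ , w)
    ≡⟨ cong₂ _∧_ (cong not (biOccurs-pairs π l σ w)) (biAvoids-pairs Υ ls σ w) ⟩
  not (anyPair occurs zs) ∧ not (anyPair (pairOccursᵇ Υ) zs)
    ≡⟨ not-∨ (anyPair occurs zs) _ ⟨
  not (anyPair occurs zs ∨ anyPair (pairOccursᵇ Υ) zs)
    ≡⟨ cong not (anyPair-∨ occurs (pairOccursᵇ Υ) zs) ⟨
  -- pairOccursᵇ (π ∷ Υ) p q unfolds to occurs p q ∨ pairOccursᵇ Υ p q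
  not (anyPair (pairOccursᵇ (π ∷ Υ)) zs) ∎
  where
  open ≡-Reasoning
  zs = zip σ w
  occurs : ℕ × ℕ → ℕ × ℕ → Bool
  occurs p q = occursInᵇ π (p ∷ q ∷ [])

anyPair-zip : (F : ℕ × ℕ → ℕ × ℕ → Bool) (R : ℕ → ℕ → Bool) →
  (∀ a b x y → (a ≡ᵇ b) ≡ false → F (a , x) (b , y) ≡ R x y) →
  ∀ σ w → T (distinctᵇ σ) → length σ ≡ length w → anyPair F (zip σ w) ≡ anyPair R w
anyPair-zip F R F≡R []      []      _        _   = refl
anyPair-zip F R F≡R (a ∷ σ) (x ∷ w) distinct len =
  cong₂ _∨_ (any-zip σ w fresh (suc-injective len)) (anyPair-zip F R F≡R σ w rest (suc-injective len))
  where
  fresh = proj₁ (Equivalence.to T-∧ distinct)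
  rest  = proj₂ (Equivalence.to T-∧ distinct)
  any-zip : ∀ σ w → T (not (any (a ≡ᵇ_) σ)) → length σ ≡ length w →
    any (F (a , x)) (zip σ w) ≡ any (R x) w
  any-zip []      []      _     _   = refl
  -- no clause for a ≡ᵇ b = true: fresh then has the empty type T false
  any-zip (b ∷ σ) (y ∷ w) fresh len with a ≡ᵇ b in a≢b
  ... | false = cong₂ _∨_ (F≡R a b x y a≢b) (any-zip σ w fresh (suc-injective len))

<ᵇ-irrefl : ∀ a → (a <ᵇ a) ≡ false
<ᵇ-irrefl zero    = refl
<ᵇ-irrefl (suc a) = <ᵇ-irrefl a

<⇒<ᵇ≡true : ∀ {a b} → a < b → (a <ᵇ b) ≡ true
<⇒<ᵇ≡true a<b = Equivalence.to T-≡ (<⇒<ᵇ a<b)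

≤⇒<ᵇ≡false : ∀ {a b} → b ≤ a → (a <ᵇ b) ≡ false
≤⇒<ᵇ≡false {a} {b} b≤a = ¬-not (λ a<b → <⇒≱ (<ᵇ⇒< a b (Equivalence.from T-≡ a<b)) b≤a)

≢⇒≡ᵇ≡false : ∀ {a b} → a ≢ b → (a ≡ᵇ b) ≡ false
≢⇒≡ᵇ≡false {a} {b} a≢b = ¬-not (λ a≡b → a≢b (≡ᵇ⇒≡ a b (Equivalence.from T-≡ a≡b)))

≡ᵇ-refl : ∀ a → (a ≡ᵇ a) ≡ true
≡ᵇ-refl a = Equivalence.to T-≡ (≡⇒≡ᵇ a a refl)

≤⇒≤ᵇ≡true : ∀ {a b} → a ≤ b → (a ≤ᵇ b) ≡ true
≤⇒≤ᵇ≡true a≤b = Equivalence.to T-≡ (≤⇒≤ᵇ a≤b)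

<⇒≤ᵇ≡false : ∀ {a b} → b < a → (a ≤ᵇ b) ≡ false
<⇒≤ᵇ≡false {a} {b} b<a = ¬-not (λ a≤b → <⇒≱ b<a (≤ᵇ⇒≤ a b (Equivalence.from T-≡ a≤b)))

redPerm-pair : ∀ {a b} → (a ≡ᵇ b) ≡ false → redPerm (a ∷ b ∷ []) ≡ p12 ⊎ redPerm (a ∷ b ∷ []) ≡ p21
redPerm-pair {a} {b} a≢b with <-cmp a b
... | tri< a<b _ _ rewrite <ᵇ-irrefl a | ≤⇒<ᵇ≡false (<⇒≤ a<b) | <⇒<ᵇ≡true a<b | <ᵇ-irrefl b = inj₁ refl
... | tri> _ _ b<a rewrite <ᵇ-irrefl a | <⇒<ᵇ≡true b<a | ≤⇒<ᵇ≡false (<⇒≤ b<a) | <ᵇ-irrefl b = inj₂ refl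
... | tri≈ _ refl _ rewrite ≡ᵇ-refl a with () ← a≢b

redWord-< : ∀ {x y} → x < y → redWord (x ∷ y ∷ []) ≡ w01
redWord-< {x} {y} x<y
  rewrite ≢⇒≡ᵇ≡false (<⇒≢ x<y) | <ᵇ-irrefl x | ≤⇒<ᵇ≡false (<⇒≤ x<y) | <⇒<ᵇ≡true x<y | <ᵇ-irrefl y = refl

redWord-> : ∀ {x y} → y < x → redWord (x ∷ y ∷ []) ≡ w10
redWord-> {x} {y} y<x
  rewrite ≢⇒≡ᵇ≡false (>⇒≢ y<x) | <ᵇ-irrefl x | <⇒<ᵇ≡true y<x | ≤⇒<ᵇ≡false (<⇒≤ y<x) | <ᵇ-irrefl y = refl

redWord-≡ : ∀ x → redWord (x ∷ x ∷ []) ≡ w00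
redWord-≡ x rewrite ≡ᵇ-refl x | <ᵇ-irrefl x = refl

record DecidedByLetters (Υ : List Pattern) (R : ℕ → ℕ → Bool) : Set where
  field
    patterns-of-length-2 : All (λ π → length (proj₁ π) ≡ 2) Υ
    blind-to-order       : ∀ u → memberᵇ (p12 , u) Υ ≡ memberᵇ (p21 , u) Υ
    verdict              : ∀ x y → memberᵇ (p12 , redWord (x ∷ y ∷ [])) Υ ≡ R x y

biAvoids-pairFree : ∀ {Υ R} → DecidedByLetters Υ R →
  ∀ σ w → T (distinctᵇ σ) → length σ ≡ length w → biAvoidsᵇ Υ (σ , w) ≡ pairFreeᵇ R (λ _ → true) w
biAvoids-pairFree {Υ} {R} decided σ w distinct len = begin
  biAvoidsᵇ Υ (σ , w)
    ≡⟨ biAvoids-pairs Υ patterns-of-length-2 σ w ⟩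
  not (anyPair (pairOccursᵇ Υ) (zip σ w))
    ≡⟨ cong not (anyPair-zip (pairOccursᵇ Υ) R pair-verdict σ w distinct len) ⟩
  not (anyPair R w)
    ≡⟨ pairFreeᵇ-const-true R w ⟨
  pairFreeᵇ R (λ _ → true) w ∎
  where
  open ≡-Reasoning
  open DecidedByLetters decided
  verdict-for : ℕ → ℕ → List ℕ → Bool
  verdict-for x y τ = memberᵇ (τ , redWord (x ∷ y ∷ [])) Υ
  pair-verdict : ∀ a b x y → (a ≡ᵇ b) ≡ false → pairOccursᵇ Υ (a , x) (b , y) ≡ R x y
  pair-verdict a b x y a≢b with redPerm-pair {a} {b} a≢b
  ... | inj₁ is-p12 = trans (cong (verdict-for x y) is-p12) (verdict x y)
  ... | inj₂ is-p21 =
    trans (cong (verdict-for x y) is-p21) (trans (sym (blind-to-order (redWord (x ∷ y ∷ [])))) (verdict x y))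

verdict-by-comparison : (Υ : List Pattern) (R : ℕ → ℕ → Bool) →
  (∀ {x y} → x < y → memberᵇ (p12 , w01) Υ ≡ R x y) →
  (∀ x → memberᵇ (p12 , w00) Υ ≡ R x x) →
  (∀ {x y} → y < x → memberᵇ (p12 , w10) Υ ≡ R x y) →
  ∀ x y → memberᵇ (p12 , redWord (x ∷ y ∷ [])) Υ ≡ R x y
verdict-by-comparison Υ R lt eq gt x y with <-cmp x y
... | tri< x<y _ _  = trans (cong (λ u → memberᵇ (p12 , u) Υ) (redWord-< x<y)) (lt x<y)
... | tri≈ _ refl _ = trans (cong (λ u → memberᵇ (p12 , u) Υ) (redWord-≡ x)) (eq x)
... | tri> _ _ y<x  = trans (cong (λ u → memberᵇ (p12 , u) Υ) (redWord-> y<x)) (gt y<x)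

Υ₁-decided : DecidedByLetters Υ₁ _≡ᵇ_
Υ₁-decided = record
  { patterns-of-length-2 = refl ∷ refl ∷ []
  ; blind-to-order       = λ _ → refl
  ; verdict              = verdict-by-comparison Υ₁ _≡ᵇ_
      (λ x<y → sym (≢⇒≡ᵇ≡false (<⇒≢ x<y))) (λ x → sym (≡ᵇ-refl x)) (λ y<x → sym (≢⇒≡ᵇ≡false (>⇒≢ y<x)))
  }

Υ₂-decided : DecidedByLetters Υ₂ (λ x y → not (x ≤ᵇ y))
Υ₂-decided = record
  { patterns-of-length-2 = refl ∷ refl ∷ []
  ; blind-to-order       = λ _ → refl
  ; verdict              = verdict-by-comparison Υ₂ _
      (λ x<y → sym (cong not (≤⇒≤ᵇ≡true (<⇒≤ x<y)))) (λ x → sym (cong not (≤⇒≤ᵇ≡true (≤-refl {x}))))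
      (λ y<x → sym (cong not (<⇒≤ᵇ≡false y<x)))
  }

Υ₃-decided : DecidedByLetters Υ₃ (λ x y → not (suc x ≤ᵇ y))
Υ₃-decided = record
  { patterns-of-length-2 = refl ∷ refl ∷ refl ∷ refl ∷ []
  ; blind-to-order       = λ _ → refl
  ; verdict              = verdict-by-comparison Υ₃ _
      (λ x<y → sym (cong not (<⇒<ᵇ≡true x<y))) (λ x → sym (cong not (<ᵇ-irrefl x)))
      (λ y<x → sym (cong not (≤⇒<ᵇ≡false (<⇒≤ y<x))))
  }

Υ₄-decided : DecidedByLetters Υ₄ (λ x y → not (x ≡ᵇ y))
Υ₄-decided = record
  { patterns-of-length-2 = refl ∷ refl ∷ refl ∷ refl ∷ []
  ; blind-to-order       = λ _ → refl
  ; verdict              = verdict-by-comparison Υ₄ _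
      (λ x<y → sym (cong not (≢⇒≡ᵇ≡false (<⇒≢ x<y)))) (λ x → sym (cong not (≡ᵇ-refl x)))
      (λ y<x → sym (cong not (≢⇒≡ᵇ≡false (>⇒≢ y<x))))
  }

wordsOver-length : (L : List ℕ) (m : ℕ) → All (λ w → length w ≡ m) (wordsOver L m)
wordsOver-length L zero    = refl ∷ []
wordsOver-length L (suc m) =
  concat⁺ (map⁺ (All.universal (λ _ → map⁺ (All.map (cong suc) (wordsOver-length L m))) L))

count-wordsOver-suc : (p : List ℕ → Bool) (g : ℕ → ℕ) (k m : ℕ) →
  count p (wordsOver (applyUpTo g k) (suc m))
    ≡ ∑ k (λ i → count (λ w → p (g i ∷ w)) (wordsOver (applyUpTo g k) m))
count-wordsOver-suc p g k m =
  trans (count-concatMap p (λ a → map (a ∷_) (wordsOver (applyUpTo g k) m)) g k)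
        (∑-cong k (λ i _ → count-map p (g i ∷_) (wordsOver (applyUpTo g k) m)))

count-pairFreeᵇ-suc : (R : ℕ → ℕ → Bool) (P : ℕ → Bool) (g : ℕ → ℕ) (k m : ℕ) →
  count (pairFreeᵇ R P) (wordsOver (applyUpTo g k) (suc m))
    ≡ ∑ k (λ i → if P (g i)
                 then count (pairFreeᵇ R (λ y → P y ∧ not (R (g i) y))) (wordsOver (applyUpTo g k) m)
                 else 0)
count-pairFreeᵇ-suc R P g k m =
  trans (count-wordsOver-suc (pairFreeᵇ R P) g k m) (∑-cong k λ i _ →
    trans (count-cong (pairFreeᵇ-∷ R P (g i)) W)
          (count-∧ˡ (P (g i)) (pairFreeᵇ R (λ y → P y ∧ not (R (g i) y))) W))
  where W = wordsOver (applyUpTo g k) m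

fallingFactorial : ℕ → ℕ → ℕ
fallingFactorial r zero    = 1
fallingFactorial r (suc m) = r * fallingFactorial (r ∸ 1) m

count-without-letter : (g : ℕ → ℕ) → (∀ i j → (g i ≡ᵇ g j) ≡ (i ≡ᵇ j)) →
  (P : ℕ → Bool) (k i : ℕ) → i < k → P (g i) ≡ true →
  suc (count (λ y → P y ∧ not (g i ≡ᵇ y)) (applyUpTo g k)) ≡ count P (applyUpTo g k)
count-without-letter g g-inj P (suc k) zero _ Pg₀ rewrite g-inj 0 0 | ∧-zeroʳ (P (g 0)) | Pg₀ =
  cong suc (count-congᴬ (applyUpTo⁺₂ (g ∘ suc) k (λ j →
    trans (cong (λ b → P (g (suc j)) ∧ not b) (g-inj 0 (suc j))) (∧-identityʳ _))))
count-without-letter g g-inj P (suc k) (suc i) (s≤s i<k) Pgᵢ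
  rewrite g-inj (suc i) 0 | ∧-identityʳ (P (g 0)) with P (g 0)
... | true  = cong suc (count-without-letter (g ∘ suc) (λ i j → g-inj (suc i) (suc j)) P k i i<k Pgᵢ)
... | false = count-without-letter (g ∘ suc) (λ i j → g-inj (suc i) (suc j)) P k i i<k Pgᵢ

count-injective-words-satisfying : (g : ℕ → ℕ) → (∀ i j → (g i ≡ᵇ g j) ≡ (i ≡ᵇ j)) →
  (P : ℕ → Bool) (k m : ℕ) →
  count (pairFreeᵇ _≡ᵇ_ P) (wordsOver (applyUpTo g k) m) ≡ fallingFactorial (count P (applyUpTo g k)) m
count-injective-words-satisfying g g-inj P k zero    = refl
count-injective-words-satisfying g g-inj P k (suc m) = begin
  count (pairFreeᵇ _≡ᵇ_ P) (wordsOver (applyUpTo g k) (suc m))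
    ≡⟨ count-pairFreeᵇ-suc _≡ᵇ_ P g k m ⟩
  ∑ k (λ i → if P (g i) then count (pairFreeᵇ _≡ᵇ_ (P-without i)) (wordsOver (applyUpTo g k) m) else 0)
    ≡⟨ ∑-cong k tail-count ⟩
  ∑ k (λ i → if P (g i) then fallingFactorial (r ∸ 1) m else 0)
    ≡⟨ ∑-indicator P g k _ ⟩
  r * fallingFactorial (r ∸ 1) m ∎
  where
  open ≡-Reasoning
  r = count P (applyUpTo g k)
  P-without : ℕ → ℕ → Bool
  P-without i y = P y ∧ not (g i ≡ᵇ y)
  tail-count : ∀ i → i < k →
    (if P (g i) then count (pairFreeᵇ _≡ᵇ_ (P-without i)) (wordsOver (applyUpTo g k) m) else 0)
      ≡ (if P (g i) then fallingFactorial (r ∸ 1) m else 0)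
  tail-count i i<k with P (g i) in Pgᵢ
  ... | false = refl
  ... | true  = trans (count-injective-words-satisfying g g-inj (P-without i) k m)
                      (cong (λ c → fallingFactorial (c ∸ 1) m) (count-without-letter g g-inj P k i i<k Pgᵢ))

count-injective-words : (g : ℕ → ℕ) → (∀ i j → (g i ≡ᵇ g j) ≡ (i ≡ᵇ j)) → (k m : ℕ) →
  count (pairFreeᵇ _≡ᵇ_ (λ _ → true)) (wordsOver (applyUpTo g k) m) ≡ fallingFactorial k m
count-injective-words g g-inj k m =
  trans (count-injective-words-satisfying g g-inj (λ _ → true) k m)
        (cong (λ r → fallingFactorial r m) (trans (count-const-true (applyUpTo g k)) (length-applyUpTo g k)))

C-absorption : ∀ k n → suc n * (suc k C suc n) ≡ suc k * (k C n)
C-absorption zero    zero    = refl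
C-absorption zero    (suc n) = *-zeroʳ (suc (suc n))
C-absorption (suc k) zero    = trans (+-identityʳ _) (trans (nC1≡n (suc (suc k))) (sym (*-identityʳ _)))
C-absorption (suc k) (suc n) = begin
  suc (suc n) * (suc (suc k) C suc (suc n))
    ≡⟨ cong (suc (suc n) *_) (nCk+nC[k+1]≡[n+1]C[k+1] (suc k) (suc n)) ⟨
  suc (suc n) * (a + b)
    ≡⟨ *-distribˡ-+ (suc (suc n)) a b ⟩
  (a + suc n * a) + suc (suc n) * b
    ≡⟨ cong₂ (λ x y → (a + x) + y) (C-absorption k n) (C-absorption k (suc n)) ⟩
  (a + suc k * (k C n)) + suc k * (k C suc n)
    ≡⟨ +-assoc a _ _ ⟩
  a + (suc k * (k C n) + suc k * (k C suc n))
    ≡⟨ cong (a +_) (*-distribˡ-+ (suc k) (k C n) (k C suc n)) ⟨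
  a + suc k * (k C n + k C suc n)
    ≡⟨ cong (λ z → a + suc k * z) (nCk+nC[k+1]≡[n+1]C[k+1] k n) ⟩
  suc (suc k) * a ∎
  where
  open ≡-Reasoning
  a = suc k C suc n
  b = suc k C suc (suc n)

fallingFactorial≡C*! : ∀ k n → fallingFactorial k n ≡ (k C n) * n !
fallingFactorial≡C*! k       zero    = refl
fallingFactorial≡C*! zero    (suc n) = refl
fallingFactorial≡C*! (suc k) (suc n) = begin
  suc k * fallingFactorial k n        ≡⟨ cong (suc k *_) (fallingFactorial≡C*! k n) ⟩
  suc k * ((k C n) * n !)             ≡⟨ *-assoc (suc k) (k C n) (n !) ⟨
  suc k * (k C n) * n !               ≡⟨ cong (_* n !) (C-absorption k n) ⟨
  suc n * (suc k C suc n) * n !       ≡⟨ cong (_* n !) (*-comm (suc n) (suc k C suc n)) ⟩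
  (suc k C suc n) * suc n * n !       ≡⟨ *-assoc (suc k C suc n) (suc n) (n !) ⟩
  (suc k C suc n) * suc n ! ∎
  where open ≡-Reasoning

fallingFactorial-n-n : ∀ n → fallingFactorial n n ≡ n !
fallingFactorial-n-n zero    = refl
fallingFactorial-n-n (suc n) = cong (suc n *_) (fallingFactorial-n-n n)

<ᵇ-suc : ∀ a b → (a <ᵇ suc b) ≡ (a ≤ᵇ b)
<ᵇ-suc zero    b = refl
<ᵇ-suc (suc a) b = refl

≤ᵇ-∧-≤ᵇ : ∀ {b c} → b ≤ c → ∀ y → (b ≤ᵇ y) ∧ (c ≤ᵇ y) ≡ (c ≤ᵇ y)
≤ᵇ-∧-≤ᵇ {b} {c} b≤c y with c ≤ᵇ y | ≤ᵇ⇒≤ c y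
... | true  | c≤y = trans (∧-identityʳ (b ≤ᵇ y)) (≤⇒≤ᵇ≡true (≤-trans b≤c (c≤y _)))
... | false | _   = ∧-zeroʳ (b ≤ᵇ y)

count-increasing-suc : (s : ℕ → ℕ) → (∀ a → a ≤ s a) → (k m b : ℕ) →
  count (pairFreeᵇ (λ x y → not (s x ≤ᵇ y)) (b ≤ᵇ_)) (wordsOver (upTo k) (suc m))
    ≡ ∑ k (λ a → if b ≤ᵇ a
                 then count (pairFreeᵇ (λ x y → not (s x ≤ᵇ y)) (s a ≤ᵇ_)) (wordsOver (upTo k) m)
                 else 0)
count-increasing-suc s inflationary k m b =
  trans (count-pairFreeᵇ-suc R (b ≤ᵇ_) (λ a → a) k m) (∑-cong k (λ a _ → restrict a))
  where
  R : ℕ → ℕ → Bool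
  R x y = not (s x ≤ᵇ y)
  restrict : ∀ a →
    (if b ≤ᵇ a then count (pairFreeᵇ R (λ y → (b ≤ᵇ y) ∧ not (R a y))) (wordsOver (upTo k) m) else 0)
      ≡ (if b ≤ᵇ a then count (pairFreeᵇ R (s a ≤ᵇ_)) (wordsOver (upTo k) m) else 0)
  restrict a with b ≤ᵇ a | ≤ᵇ⇒≤ b a
  ... | false | _   = refl
  ... | true  | b≤a = count-cong (pairFreeᵇ-cong R (λ y →
      trans (cong ((b ≤ᵇ y) ∧_) (not-involutive (s a ≤ᵇ y)))
            (≤ᵇ-∧-≤ᵇ (≤-trans (b≤a _) (inflationary a)) y))) (wordsOver (upTo k) m)

∑-C-hockey-stick : ∀ m k b → ∑ k (λ a → if b ≤ᵇ a then (k ∸ suc a) C m else 0) ≡ (k ∸ b) C suc m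
∑-C-hockey-stick m zero    zero    = refl
∑-C-hockey-stick m zero    (suc b) = refl
∑-C-hockey-stick m (suc k) zero    =
  trans (cong (k C m +_) (∑-C-hockey-stick m k 0)) (nCk+nC[k+1]≡[n+1]C[k+1] k m)
∑-C-hockey-stick m (suc k) (suc b) =
  trans (∑-cong k (λ a _ → cong (λ t → if t then (k ∸ suc a) C m else 0) (<ᵇ-suc b a)))
        (∑-C-hockey-stick m k b)

count-strictly-increasing : ∀ k m b →
  count (pairFreeᵇ (λ x y → not (suc x ≤ᵇ y)) (b ≤ᵇ_)) (wordsOver (upTo k) m) ≡ (k ∸ b) C m
count-strictly-increasing k zero    b = refl
count-strictly-increasing k (suc m) b =
  trans (count-increasing-suc suc n≤1+n k m b)
  (trans (∑-cong k (λ a _ → cong (λ c → if b ≤ᵇ a then c else 0) (count-strictly-increasing k m (suc a))))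
         (∑-C-hockey-stick m k b))

-- c multichoose m = (m + c ∸ 1) C m, split on m so that no subtraction occurs
multichoose : ℕ → ℕ → ℕ
multichoose c zero    = 1
multichoose c (suc m) = (m + c) C suc m

∑-multichoose-hockey-stick : ∀ m k b →
  ∑ k (λ a → if b ≤ᵇ a then multichoose (k ∸ a) m else 0) ≡ multichoose (k ∸ b) (suc m)
∑-multichoose-hockey-stick m zero    b rewrite 0∸n≡0 b =
  sym (k>n⇒nCk≡0 (s≤s (≤-reflexive (+-identityʳ m))))
∑-multichoose-hockey-stick m (suc k) zero    =
  trans (cong₂ _+_ (multichoose-suc k m) (∑-multichoose-hockey-stick m k 0))
        (trans (nCk+nC[k+1]≡[n+1]C[k+1] (m + k) m) (cong (_C suc m) (sym (+-suc m k))))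
  where
  multichoose-suc : ∀ k m → multichoose (suc k) m ≡ (m + k) C m
  multichoose-suc k zero    = refl
  multichoose-suc k (suc m) = cong (_C suc m) (+-suc m k)
∑-multichoose-hockey-stick m (suc k) (suc b) =
  trans (∑-cong k (λ a _ → cong (λ t → if t then multichoose (k ∸ a) m else 0) (<ᵇ-suc b a)))
        (∑-multichoose-hockey-stick m k b)

count-weakly-increasing : ∀ k m b →
  count (pairFreeᵇ (λ x y → not (x ≤ᵇ y)) (b ≤ᵇ_)) (wordsOver (upTo k) m) ≡ multichoose (k ∸ b) m
count-weakly-increasing k zero    b = refl
count-weakly-increasing k (suc m) b =
  trans (count-increasing-suc (λ a → a) (λ a → ≤-refl) k m b)
  (trans (∑-cong k (λ a _ → cong (λ c → if b ≤ᵇ a then c else 0) (count-weakly-increasing k m a)))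
         (∑-multichoose-hockey-stick m k b))

count-≡ᵇ-upTo : ∀ k a → a < k → count (a ≡ᵇ_) (upTo k) ≡ 1
count-≡ᵇ-upTo k a a<k = begin
  count (a ≡ᵇ_) (upTo k)
    ≡⟨ count-without-letter (λ i → i) (λ _ _ → refl) (a ≡ᵇ_) k a a<k (≡ᵇ-refl a) ⟨
  suc (count (λ y → (a ≡ᵇ y) ∧ not (a ≡ᵇ y)) (upTo k))
    ≡⟨ cong suc (count-cong (λ y → ∧-inverseʳ (a ≡ᵇ y)) (upTo k)) ⟩
  suc (count (λ _ → false) (upTo k))
    ≡⟨ cong suc (count-const-false (upTo k)) ⟩
  1 ∎
  where open ≡-Reasoning

count-constant-from : ∀ k m a → a < k →
  count (pairFreeᵇ (λ x y → not (x ≡ᵇ y)) (a ≡ᵇ_)) (wordsOver (upTo k) m) ≡ 1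
count-constant-from k zero    a a<k = refl
count-constant-from k (suc m) a a<k = begin
  count (pairFreeᵇ R (a ≡ᵇ_)) (wordsOver (upTo k) (suc m))
    ≡⟨ count-pairFreeᵇ-suc R (a ≡ᵇ_) (λ c → c) k m ⟩
  ∑ k (λ c → if a ≡ᵇ c then count (pairFreeᵇ R (λ y → (a ≡ᵇ y) ∧ not (R c y))) W else 0)
    ≡⟨ ∑-cong k (λ c _ → only-a c) ⟩
  ∑ k (λ c → if a ≡ᵇ c then 1 else 0)
    ≡⟨ ∑-indicator (a ≡ᵇ_) (λ c → c) k 1 ⟩
  count (a ≡ᵇ_) (upTo k) * 1
    ≡⟨ trans (*-identityʳ _) (count-≡ᵇ-upTo k a a<k) ⟩
  1 ∎
  where
  open ≡-Reasoning
  R : ℕ → ℕ → Bool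
  R x y = not (x ≡ᵇ y)
  W = wordsOver (upTo k) m
  only-a : ∀ c →
    (if a ≡ᵇ c then count (pairFreeᵇ R (λ y → (a ≡ᵇ y) ∧ not (R c y))) W else 0) ≡ (if a ≡ᵇ c then 1 else 0)
  only-a c with a ≡ᵇ c | ≡ᵇ⇒≡ a c
  ... | false | _   = refl
  ... | true  | a≡c with refl ← a≡c _ =
    trans (count-cong (pairFreeᵇ-cong R (λ y →
            trans (cong ((a ≡ᵇ y) ∧_) (not-involutive (a ≡ᵇ y))) (∧-idem (a ≡ᵇ y)))) W)
          (count-constant-from k m a a<k)

count-constant : ∀ k m →
  count (pairFreeᵇ (λ x y → not (x ≡ᵇ y)) (λ _ → true)) (wordsOver (upTo k) (suc m)) ≡ k
count-constant k m = begin
  count (pairFreeᵇ R (λ _ → true)) (wordsOver (upTo k) (suc m))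
    ≡⟨ count-pairFreeᵇ-suc R (λ _ → true) (λ c → c) k m ⟩
  ∑ k (λ c → count (pairFreeᵇ R (λ y → not (R c y))) W)
    ≡⟨ ∑-cong k (λ c c<k → trans (count-cong (pairFreeᵇ-cong R (λ y → not-involutive (c ≡ᵇ y))) W)
                                 (count-constant-from k m c c<k)) ⟩
  ∑ k (λ _ → 1)
    ≡⟨ trans (∑-const k 1) (*-identityʳ k) ⟩
  k ∎
  where
  open ≡-Reasoning
  R : ℕ → ℕ → Bool
  R x y = not (x ≡ᵇ y)
  W = wordsOver (upTo k) m

count-product : (p : A × B → Bool) (q : B → Bool) (S : List A) (W : List B) →
  All (λ σ → All (λ w → p (σ , w) ≡ q w) W) S →
  count p (concatMap (λ σ → map (σ ,_) W) S) ≡ length S * count q W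
count-product p q []      W []         = refl
count-product p q (σ ∷ S) W (eqs ∷ eqss) =
  trans (count-++ p (map (σ ,_) W) _)
        (cong₂ _+_ (trans (count-map p (σ ,_) W) (count-congᴬ eqs)) (count-product p q S W eqss))

distinctᵇ≡pairFreeᵇ : ∀ w → distinctᵇ w ≡ pairFreeᵇ _≡ᵇ_ (λ _ → true) w
distinctᵇ≡pairFreeᵇ w = trans (distinct≡noPair w) (sym (pairFreeᵇ-const-true _≡ᵇ_ w))
  where
  distinct≡noPair : ∀ w → distinctᵇ w ≡ not (anyPair _≡ᵇ_ w)
  distinct≡noPair []       = refl
  distinct≡noPair (x ∷ xs) =
    trans (cong (not (any (x ≡ᵇ_) xs) ∧_) (distinct≡noPair xs)) (sym (not-∨ (any (x ≡ᵇ_) xs) _))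

perms-length : ∀ n → length (perms n) ≡ n !
perms-length n = begin
  count distinctᵇ (wordsOver (map suc (upTo n)) n)
    ≡⟨ count-cong distinctᵇ≡pairFreeᵇ (wordsOver (map suc (upTo n)) n) ⟩
  count (pairFreeᵇ _≡ᵇ_ (λ _ → true)) (wordsOver (map suc (upTo n)) n)
    ≡⟨ cong (λ L → count (pairFreeᵇ _≡ᵇ_ (λ _ → true)) (wordsOver L n)) (map-upTo suc n) ⟩
  count (pairFreeᵇ _≡ᵇ_ (λ _ → true)) (wordsOver (applyUpTo suc n) n)
    ≡⟨ count-injective-words suc (λ _ _ → refl) n n ⟩
  fallingFactorial n n
    ≡⟨ fallingFactorial-n-n n ⟩
  n ! ∎
  where open ≡-Reasoning

perms-distinct : ∀ n → All (λ σ → T (distinctᵇ σ) × length σ ≡ n) (perms n)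
perms-distinct n = All.zip (all-filter (T? ∘ distinctᵇ) W , filter⁺ (T? ∘ distinctᵇ) (wordsOver-length L n))
  where
  L = map suc (upTo n)
  W = wordsOver L n

Av≡count*! : ∀ {Υ R} → DecidedByLetters Υ R →
  ∀ n k → Av n k Υ ≡ count (pairFreeᵇ R (λ _ → true)) (kwords k n) * n !
Av≡count*! {Υ} {R} decided n k =
  trans (count-product (biAvoidsᵇ Υ) (pairFreeᵇ R (λ _ → true)) (perms n) (kwords k n) product-verdict)
        (trans (cong (_* count (pairFreeᵇ R (λ _ → true)) (kwords k n)) (perms-length n))
               (*-comm (n !) _))
  where
  product-verdict :
    All (λ σ → All (λ w → biAvoidsᵇ Υ (σ , w) ≡ pairFreeᵇ R (λ _ → true) w) (kwords k n)) (perms n)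
  product-verdict = All.map (λ {σ} (distinct , |σ|≡n) → All.map (λ {w} |w|≡n →
      biAvoids-pairFree decided σ w distinct (trans |σ|≡n (sym |w|≡n))) (wordsOver-length (upTo k) n))
    (perms-distinct n)

theorem4 : (n k : ℕ) → 1 ≤ n → 1 ≤ k →
    (Av n k Υ₁ ≡ (k C n) * n ! * n !) ×
    (Av n k Υ₂ ≡ ((n + k ∸ 1) C n) * n !) ×
    (Av n k Υ₃ ≡ (k C n) * n !) ×
    (Av n k Υ₄ ≡ k * n !)
theorem4 n@(suc m) k _ _ =
    trans (Av≡count*! Υ₁-decided n k)
          (cong (_* n !) (trans (count-injective-words (λ i → i) (λ _ _ → refl) k n)
                                (fallingFactorial≡C*! k n)))
  , trans (Av≡count*! Υ₂-decided n k) (cong (_* n !) (count-weakly-increasing k n 0))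
  , trans (Av≡count*! Υ₃-decided n k) (cong (_* n !) (count-strictly-increasing k n 0))
  , trans (Av≡count*! Υ₄-decided n k) (cong (_* n !) (count-constant k m))
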